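{- Let $k\in\mathbb{Z}_{\geq 0}$. If a positive integer triplet $(a,b,c)$ is a solution of \[x^2+y^4+z^4+ky^2z^2+2xy^2+2xz^2=(7+k)xy^2z^2, \qquad (\ast\ast)\] then $(a,b^2,c^2)$ is a solution of \[X^2+Y^2+Z^2+2XY+kYZ+2ZX=(7+k)XYZ. \qquad (\ddagger)\] Conversely, if a positive integer triplet $(A,B,C)$ is a solution of $(\ddagger)$, then $(A,\sqrt{B},\sqrt{C})$ is a positive integer solution of $(\ast\ast)$. -}

module Defs where

open import Data.Nat using (ℕ; _+_; _*_; _^_)
open import Relation.Binary.PropositionalEquality using (_≡_)

IsSolStar : ℕ → ℕ → ℕ → ℕ → Set
IsSolStar k x y z =
  x ^ 2 + y ^ 4 + z ^ 4 + k * y ^ 2 * z ^ 2 + 2 * x * y ^ 2 + 2 * x * z ^ 2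
    ≡ (7 + k) * x * y ^ 2 * z ^ 2

IsSolDagger : ℕ → ℕ → ℕ → ℕ → Set
IsSolDagger k X Y Z =
  X ^ 2 + Y ^ 2 + Z ^ 2 + 2 * X * Y + k * Y * Z + 2 * Z * X
    ≡ (7 + k) * X * Y * Z

{-# OPTIONS --safe #-}
module Submission where

-- The forward direction is a polynomial identity. For the converse, (‡) is a monic quadratic in each
-- of X, Y and Z, so Vieta jumping replaces one coordinate of a positive solution by the other root and
-- gives another positive solution; by descent on X + Y + Z we may assume no jump makes the solution
-- smaller, and then (‡) together with the resulting bounds Y ≤ X + Z, Z ≤ X + Y, X² ≤ Y² + Z² + kYZ
-- leaves only Y = 1. The invariant carried back up is Y = b² with b ∣ X + Z: a jump in Y keeps it
-- because Y Y' = (X + Z)², a jump in X or Z because (X + Z) + (X' + Z) and (X + Z) + (X + Z') are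
-- multiples of Y. By the symmetry Y ↔ Z of (‡), Z is a square as well.

open import Defs
open import Data.Nat using (ℕ; _<_; _^_; zero; suc; _+_; _*_; _≤_; z≤n; s≤s; s≤s⁻¹; _<?_; _≤?_)
open import Data.Nat.Properties
open import Data.Nat.Divisibility using (_∣_; divides; 1∣_; n∣m*n; ∣m+n∣m⇒∣n; ∣m∣n⇒∣m+n; ∣n⇒∣m*n)
open import Data.Nat.Tactic.RingSolver using (solve-∀)
open import Data.Nat.Solver using (module +-*-Solver)
open +-*-Solver using (solve; _:=_; con; _:+_; _:*_; _:^_)
open import Algebra.Properties.CommutativeSemigroup *-commutativeSemigroup using (xy∙z≈xz∙y)
open import Data.Product using (_×_; ∃-syntax; _,_)
open import Data.Sum using (inj₁; inj₂; [_,_]′)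
open import Data.Empty using (⊥; ⊥-elim)
open import Function.Bundles using (_⇔_; mk⇔; Equivalence)
open Equivalence using (to; from)
open import Relation.Nullary using (yes; no; contradiction)
open import Relation.Binary.PropositionalEquality using (_≡_; refl; sym; trans; cong; subst; subst₂; module ≡-Reasoning)

≡-cong₂-⇔ : ∀ {a b c d : ℕ} → a ≡ c → b ≡ d → (a ≡ b) ⇔ (c ≡ d)
≡-cong₂-⇔ a≡c b≡d = mk⇔ (subst₂ _≡_ a≡c b≡d) (subst₂ _≡_ (sym a≡c) (sym b≡d))

vieta-partner : ∀ {L P N} Y → 0 < Y → Y * (Y + L) + P ≡ N * Y →
  ∃[ Y' ] (Y' + (Y + L) ≡ N × Y * Y' ≡ P × Y' * (Y' + L) + P ≡ N * Y')
vieta-partner {L} {P} {N} Y@(suc _) _ eq with m≤n⇒∃[o]m+o≡n Y+L≤N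
  where
  Y+L≤N : Y + L ≤ N
  Y+L≤N = *-cancelʳ-≤ (Y + L) N Y (begin
    (Y + L) * Y       ≡⟨ *-comm (Y + L) Y ⟩
    Y * (Y + L)       ≤⟨ m≤m+n _ P ⟩
    Y * (Y + L) + P   ≡⟨ eq ⟩
    N * Y             ∎)
    where open ≤-Reasoning
... | Y' , refl = Y' , +-comm Y' (Y + L) , product , partner-root
  where
  open ≡-Reasoning
  product : Y * Y' ≡ P
  product = +-cancelˡ-≡ (Y * (Y + L)) (Y * Y') P (begin
    Y * (Y + L) + Y * Y' ≡⟨ split Y L Y' ⟩
    (Y + L + Y') * Y     ≡⟨ sym eq ⟩
    Y * (Y + L) + P      ∎)
    where
    split : ∀ Y L Y' → Y * (Y + L) + Y * Y' ≡ (Y + L + Y') * Y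
    split = solve-∀
  partner-root : Y' * (Y' + L) + P ≡ (Y + L + Y') * Y'
  partner-root = begin
    Y' * (Y' + L) + P      ≡⟨ cong (Y' * (Y' + L) +_) (sym product) ⟩
    Y' * (Y' + L) + Y * Y' ≡⟨ collect Y L Y' ⟩
    (Y + L + Y') * Y'      ∎
    where
    collect : ∀ Y L Y' → Y' * (Y' + L) + Y * Y' ≡ (Y + L + Y') * Y'
    collect = solve-∀

positive-cofactor : ∀ m {n p} → m * n ≡ p → 0 < p → 0 < n
positive-cofactor m {zero} refl 0<p = ⊥-elim (<-irrefl (sym (*-zeroʳ m)) 0<p)
positive-cofactor m {suc _} _ _ = s≤s z≤n

positive-square-sum : ∀ {m} n → 0 < m → 0 < (m + n) * (m + n)
positive-square-sum {m} n 0<m = *-mono-< 0<m+n 0<m+n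
  where
  0<m+n : 0 < m + n
  0<m+n = <-≤-trans 0<m (m≤m+n m n)

≤-cofactor⇒≤-root : ∀ {m n r} → m ≤ n → m * n ≡ r * r → m ≤ r
≤-cofactor⇒≤-root {m} {n} {r} m≤n mn≡rr = ≮⇒≥ λ r<m → <⇒≱ (*-mono-< r<m r<m) (begin
  m * m ≤⟨ *-monoʳ-≤ m m≤n ⟩
  m * n ≡⟨ mn≡rr ⟩
  r * r ∎)
  where open ≤-Reasoning

RootDivides : ℕ → ℕ → Set
RootDivides Y M = ∃[ b ] (b * b ≡ Y × b ∣ M)

RootDivides-cofactor : ∀ {Y Y' M} → 0 < Y' → Y * Y' ≡ M * M → RootDivides Y' M → RootDivides Y M
RootDivides-cofactor () _ (zero , refl , _)
RootDivides-cofactor {Y} _ YY'≡MM (s@(suc _) , refl , divides t refl) =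
  t , sym Y≡tt , divides s (*-comm t s)
  where
  Y≡tt : Y ≡ t * t
  Y≡tt = *-cancelʳ-≡ Y (t * t) (s * s) (trans YY'≡MM (interchange t s))
    where
    interchange : ∀ t s → (t * s) * (t * s) ≡ (t * t) * (s * s)
    interchange = solve-∀

RootDivides-shift : ∀ {Y u v} a c → RootDivides Y u → u + a * Y + v ≡ c * Y → RootDivides Y v
RootDivides-shift a c (b , refl , b∣u) sum =
  b , refl , ∣m+n∣m⇒∣n (subst (b ∣_) (sym sum) (∣n⇒∣m*n c b∣Y)) (∣m∣n⇒∣m+n b∣u (∣n⇒∣m*n a b∣Y))
  where
  b∣Y : b ∣ b * b
  b∣Y = n∣m*n b

-- Squares are written as products away from Defs: solve-∀ treats _^_ as an opaque constant, so the
-- identities that involve the _^_ of Defs are proved with Data.Nat.Solver instead.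

DaggerInY : ℕ → ℕ → ℕ → ℕ → Set
DaggerInY k X Y Z = Y * (Y + (2 * X + k * Z)) + (X + Z) * (X + Z) ≡ (7 + k) * X * Z * Y

DaggerInX : ℕ → ℕ → ℕ → ℕ → Set
DaggerInX k X Y Z = X * (X + (2 * Y + 2 * Z)) + (Y * Y + Z * Z + k * Y * Z) ≡ (7 + k) * Y * Z * X

star⇔dagger : ∀ k a b c → IsSolStar k a b c ⇔ IsSolDagger k a (b ^ 2) (c ^ 2)
star⇔dagger k a b c = ≡-cong₂-⇔
  (solve 4 (λ k a b c →
      a :^ 2 :+ b :^ 4 :+ c :^ 4 :+ k :* b :^ 2 :* c :^ 2 :+ con 2 :* a :* b :^ 2 :+ con 2 :* a :* c :^ 2
   := a :^ 2 :+ (b :^ 2) :^ 2 :+ (c :^ 2) :^ 2 :+ con 2 :* a :* b :^ 2 :+ k :* b :^ 2 :* c :^ 2 :+ con 2 :* c :^ 2 :* a)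
   refl k a b c)
  refl

dagger-swap : ∀ k X Y Z → IsSolDagger k X Y Z → IsSolDagger k X Z Y
dagger-swap k X Y Z = subst₂ _≡_
  (solve 4 (λ k X Y Z →
      X :^ 2 :+ Y :^ 2 :+ Z :^ 2 :+ con 2 :* X :* Y :+ k :* Y :* Z :+ con 2 :* Z :* X
   := X :^ 2 :+ Z :^ 2 :+ Y :^ 2 :+ con 2 :* X :* Z :+ k :* Z :* Y :+ con 2 :* Y :* X)
   refl k X Y Z)
  (solve 4 (λ k X Y Z → (con 7 :+ k) :* X :* Y :* Z := (con 7 :+ k) :* X :* Z :* Y) refl k X Y Z)

dagger⇔in-Y : ∀ k X Y Z → IsSolDagger k X Y Z ⇔ DaggerInY k X Y Z
dagger⇔in-Y k X Y Z = ≡-cong₂-⇔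
  (solve 4 (λ k X Y Z →
      X :^ 2 :+ Y :^ 2 :+ Z :^ 2 :+ con 2 :* X :* Y :+ k :* Y :* Z :+ con 2 :* Z :* X
   := Y :* (Y :+ (con 2 :* X :+ k :* Z)) :+ (X :+ Z) :* (X :+ Z))
   refl k X Y Z)
  (solve 4 (λ k X Y Z → (con 7 :+ k) :* X :* Y :* Z := (con 7 :+ k) :* X :* Z :* Y) refl k X Y Z)

dagger⇔in-X : ∀ k X Y Z → IsSolDagger k X Y Z ⇔ DaggerInX k X Y Z
dagger⇔in-X k X Y Z = ≡-cong₂-⇔
  (solve 4 (λ k X Y Z →
      X :^ 2 :+ Y :^ 2 :+ Z :^ 2 :+ con 2 :* X :* Y :+ k :* Y :* Z :+ con 2 :* Z :* X
   := X :* (X :+ (con 2 :* Y :+ con 2 :* Z)) :+ (Y :* Y :+ Z :* Z :+ k :* Y :* Z))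
   refl k X Y Z)
  (solve 4 (λ k X Y Z → (con 7 :+ k) :* X :* Y :* Z := (con 7 :+ k) :* Y :* Z :* X) refl k X Y Z)

exceeds-bound : ∀ {l r b q} → l ≡ r → l ≤ b → r ≡ b + suc q → ⊥
exceeds-bound {b = b} l≡r l≤b r≡b+1+q = m+1+n≰m b (subst (_≤ b) (trans l≡r r≡b+1+q) l≤b)

in-Y-lhs-bound : ∀ k X Y Z → Z ≤ Y → Y ≤ X + Z → X * X ≤ Y * Y + Z * Z + k * Y * Z →
  Y * (Y + (2 * X + k * Z)) + (X + Z) * (X + Z) ≤ 4 * X * Y + 2 * X * Z + (4 + 2 * k) * Y * Z
in-Y-lhs-bound k X Y Z Z≤Y Y≤X+Z XX≤C = begin
  Y * (Y + (2 * X + k * Z)) + (X + Z) * (X + Z)   ≡⟨ regroup k X Y Z ⟩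
  X * X + C + R                                   ≤⟨ +-monoˡ-≤ R (+-monoˡ-≤ C XX≤C) ⟩
  C + C + R                                       ≡⟨ double k X Y Z ⟩
  2 * (Y * Y + Z * Z) + R'                        ≤⟨ +-monoˡ-≤ R' (*-monoʳ-≤ 2 squares≤) ⟩
  2 * (Y * (X + Z) + Z * Y) + R'                  ≡⟨ collect k X Y Z ⟩
  4 * X * Y + 2 * X * Z + (4 + 2 * k) * Y * Z     ∎
  where
  open ≤-Reasoning
  C = Y * Y + Z * Z + k * Y * Z
  R = 2 * X * Y + 2 * X * Z
  R' = 2 * k * Y * Z + 2 * X * Y + 2 * X * Z
  squares≤ : Y * Y + Z * Z ≤ Y * (X + Z) + Z * Y
  squares≤ = +-mono-≤ (*-monoʳ-≤ Y Y≤X+Z) (*-monoʳ-≤ Z Z≤Y)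
  regroup : ∀ k X Y Z → Y * (Y + (2 * X + k * Z)) + (X + Z) * (X + Z)
                      ≡ X * X + (Y * Y + Z * Z + k * Y * Z) + (2 * X * Y + 2 * X * Z)
  regroup = solve-∀
  double : ∀ k X Y Z → (Y * Y + Z * Z + k * Y * Z) + (Y * Y + Z * Z + k * Y * Z) + (2 * X * Y + 2 * X * Z)
                     ≡ 2 * (Y * Y + Z * Z) + (2 * k * Y * Z + 2 * X * Y + 2 * X * Z)
  double = solve-∀
  collect : ∀ k X Y Z → 2 * (Y * (X + Z) + Z * Y) + (2 * k * Y * Z + 2 * X * Y + 2 * X * Z)
                      ≡ 4 * X * Y + 2 * X * Z + (4 + 2 * k) * Y * Z
  collect = solve-∀

-- In every excluded case the right-hand side of (‡) equals a bound on its left-hand side (the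
-- left-hand side itself, or in-Y-lhs-bound) plus 1 + a polynomial with natural coefficients.
sorted-minimal⇒Y≡1 : ∀ k X Y Z → 0 < X → 0 < Z → DaggerInY k X Y Z → Z ≤ Y → Y ≤ X + Z →
  X * X ≤ Y * Y + Z * Z + k * Y * Z → Y ≡ 1
sorted-minimal⇒Y≡1 _ _ 1 _ _ _ _ _ _ _ = refl
sorted-minimal⇒Y≡1 k 1 2 1 _ _ E _ _ _ = ⊥-elim (exceeds-bound E ≤-refl (at-1-2-1 k))
  where
  at-1-2-1 : ∀ k → (7 + k) * 1 * 1 * 2 ≡ 2 * (2 + (2 * 1 + k * 1)) + 2 * 2 + suc 1
  at-1-2-1 = solve-∀
sorted-minimal⇒Y≡1 _ 1 (suc (suc (suc _))) 1 _ _ _ _ (s≤s (s≤s ())) _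
sorted-minimal⇒Y≡1 k 2 2 1 _ _ E _ _ _ = ⊥-elim (exceeds-bound E ≤-refl (at-2-2-1 k))
  where
  at-2-2-1 : ∀ k → (7 + k) * 2 * 1 * 2 ≡ 2 * (2 + (2 * 2 + k * 1)) + 3 * 3 + suc (6 + 2 * k)
  at-2-2-1 = solve-∀
sorted-minimal⇒Y≡1 k 2 3 1 _ _ E _ _ _ = ⊥-elim (exceeds-bound E ≤-refl (at-2-3-1 k))
  where
  at-2-3-1 : ∀ k → (7 + k) * 2 * 1 * 3 ≡ 3 * (3 + (2 * 2 + k * 1)) + 3 * 3 + suc (11 + 3 * k)
  at-2-3-1 = solve-∀
sorted-minimal⇒Y≡1 _ 2 (suc (suc (suc (suc _)))) 1 _ _ _ _ (s≤s (s≤s (s≤s ()))) _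
sorted-minimal⇒Y≡1 k (suc (suc (suc x))) (suc (suc y)) 1 _ _ E Z≤Y Y≤X+Z XX≤C =
  ⊥-elim (exceeds-bound E (in-Y-lhs-bound k (3 + x) (2 + y) 1 Z≤Y Y≤X+Z XX≤C) (at-3+x-2+y-1 k x y))
  where
  at-3+x-2+y-1 : ∀ k x y → (7 + k) * (3 + x) * 1 * (2 + y)
    ≡ 4 * (3 + x) * (2 + y) + 2 * (3 + x) * 1 + (4 + 2 * k) * (2 + y) * 1
      + suc (3 + 5 * y + 4 * x + 2 * k + 3 * x * y + k * y + 2 * k * x + k * x * y)
  at-3+x-2+y-1 = solve-∀
sorted-minimal⇒Y≡1 k 1 Y Z@(suc (suc z)) _ _ E Z≤Y Y≤1+Z _
  with [ (λ Y<1+Z → inj₁ (≤-antisym (s≤s⁻¹ Y<1+Z) Z≤Y)) , inj₂ ]′ (m≤n⇒m<n∨m≡n Y≤1+Z)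
... | inj₁ refl = ⊥-elim (exceeds-bound E ≤-refl (at-1-2+z-2+z k z))
  where
  at-1-2+z-2+z : ∀ k z → (7 + k) * 1 * (2 + z) * (2 + z)
    ≡ (2 + z) * ((2 + z) + (2 * 1 + k * (2 + z))) + (1 + (2 + z)) * (1 + (2 + z)) + suc (10 + 16 * z + 5 * z * z)
  at-1-2+z-2+z = solve-∀
... | inj₂ refl = ⊥-elim (exceeds-bound E ≤-refl (at-1-3+z-2+z k z))
  where
  at-1-3+z-2+z : ∀ k z → (7 + k) * 1 * (2 + z) * (3 + z)
    ≡ (3 + z) * ((3 + z) + (2 * 1 + k * (2 + z))) + (1 + (2 + z)) * (1 + (2 + z)) + suc (17 + 21 * z + 5 * z * z)
  at-1-3+z-2+z = solve-∀
sorted-minimal⇒Y≡1 k (suc (suc x)) (suc (suc y)) (suc (suc z)) _ _ E Z≤Y Y≤X+Z XX≤C =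
  ⊥-elim (exceeds-bound E (in-Y-lhs-bound k (2 + x) (2 + y) (2 + z) Z≤Y Y≤X+Z XX≤C) (at-2+x-2+y-2+z k x y z))
  where
  at-2+x-2+y-2+z : ∀ k x y z → (7 + k) * (2 + x) * (2 + z) * (2 + y)
    ≡ 4 * (2 + x) * (2 + y) + 2 * (2 + x) * (2 + z) + (4 + 2 * k) * (2 + y) * (2 + z)
      + suc (15 + 16 * z + 12 * y + 16 * x + 10 * y * z + 12 * x * z + 10 * x * y + 4 * k * x
             + 7 * x * y * z + 2 * k * x * z + 2 * k * x * y + k * x * y * z)
  at-2+x-2+y-2+z = solve-∀

-- The last three hypotheses say that none of the Vieta jumps in Y, Z, X decreases the solution.
-- The last three hypotheses say that none of the Vieta jumps in Y, Z, X decreases the solution.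
minimal⇒Y≡1 : ∀ k X Y Z → 0 < X → 0 < Y → 0 < Z → IsSolDagger k X Y Z →
  Y ≤ X + Z → Z ≤ X + Y → X * X ≤ Y * Y + Z * Z + k * Y * Z → Y ≡ 1
minimal⇒Y≡1 k X Y Z 0<X 0<Y 0<Z E Y≤X+Z Z≤X+Y XX≤C with Z ≤? Y
... | yes Z≤Y = sorted-minimal⇒Y≡1 k X Y Z 0<X 0<Z (to (dagger⇔in-Y k X Y Z) E) Z≤Y Y≤X+Z XX≤C
... | no Z≰Y = contradiction Z≡1 (>⇒≢ (≤-trans (s≤s 0<Y) Y<Z))
  where
  Y<Z : Y < Z
  Y<Z = ≰⇒> Z≰Y
  swap : ∀ k Y Z → Y * Y + Z * Z + k * Y * Z ≡ Z * Z + Y * Y + k * Z * Y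
  swap = solve-∀
  Z≡1 : Z ≡ 1
  Z≡1 = sorted-minimal⇒Y≡1 k X Z Y 0<X 0<Y (to (dagger⇔in-Y k X Z Y) (dagger-swap k X Y Z E)) (<⇒≤ Y<Z) Z≤X+Y
          (subst (X * X ≤_) (swap k Y Z) XX≤C)

dagger⇒RootDivides : ∀ k n {X Y Z} → X + Y + Z ≤ n → 0 < X → 0 < Y → 0 < Z →
  IsSolDagger k X Y Z → RootDivides Y (X + Z)
dagger⇒RootDivides k zero {suc _} () _ _ _ _
dagger⇒RootDivides k (suc n) {X} {Y} {Z} size 0<X 0<Y 0<Z E
  with vieta-partner {N = (7 + k) * X * Z} Y 0<Y (to (dagger⇔in-Y k X Y Z) E)
     | vieta-partner X 0<X (to (dagger⇔in-X k X Y Z) E)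
     | vieta-partner Z 0<Z (to (dagger⇔in-Y k X Z Y) (dagger-swap k X Y Z E))
... | Y' , _ , YY'≡ , EY' | X' , X-sum , XX'≡ , EX' | Z' , Z-sum , ZZ'≡ , EZ'
  with Y' <? Y | X' <? X | Z' <? Z
... | yes Y'<Y | _ | _ =
  RootDivides-cofactor 0<Y' YY'≡
    (dagger⇒RootDivides k n (s≤s⁻¹ (<-≤-trans (+-monoˡ-< Z (+-monoʳ-< X Y'<Y)) size))
       0<X 0<Y' 0<Z (from (dagger⇔in-Y k X Y' Z) EY'))
  where
  0<Y' : 0 < Y'
  0<Y' = positive-cofactor Y YY'≡ (positive-square-sum Z 0<X)
... | no _ | yes X'<X | _ =
  RootDivides-shift 2 ((7 + k) * Z)
    (dagger⇒RootDivides k n (s≤s⁻¹ (<-≤-trans (+-monoˡ-< Z (+-monoˡ-< Y X'<X)) size))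
       0<X' 0<Y 0<Z (from (dagger⇔in-X k X' Y Z) EX'))
    (trans (regroup k X X' Y Z) (trans X-sum (xy∙z≈xz∙y (7 + k) Y Z)))
  where
  0<X' : 0 < X'
  0<X' = positive-cofactor X XX'≡ (<-≤-trans (*-mono-< 0<Y 0<Y) (≤-trans (m≤m+n _ _) (m≤m+n _ _)))
  regroup : ∀ k X X' Y Z → X' + Z + 2 * Y + (X + Z) ≡ X' + (X + (2 * Y + 2 * Z))
  regroup = solve-∀
... | no _ | no _ | yes Z'<Z =
  RootDivides-shift k ((7 + k) * X)
    (dagger⇒RootDivides k n (s≤s⁻¹ (<-≤-trans (+-monoʳ-< (X + Y) Z'<Z) size))
       0<X 0<Y 0<Z' (dagger-swap k X Z' Y (from (dagger⇔in-Y k X Z' Y) EZ')))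
    (trans (regroup k X Y Z Z') Z-sum)
  where
  0<Z' : 0 < Z'
  0<Z' = positive-cofactor Z ZZ'≡ (positive-square-sum Y 0<X)
  regroup : ∀ k X Y Z Z' → X + Z' + k * Y + (X + Z) ≡ Z' + (Z + (2 * X + k * Y))
  regroup = solve-∀
... | no Y'≮Y | no X'≮X | no Z'≮Z = 1 , sym Y≡1 , 1∣ (X + Z)
  where
  Y≡1 : Y ≡ 1
  Y≡1 = minimal⇒Y≡1 k X Y Z 0<X 0<Y 0<Z E
    (≤-cofactor⇒≤-root (≮⇒≥ Y'≮Y) YY'≡) (≤-cofactor⇒≤-root (≮⇒≥ Z'≮Z) ZZ'≡)
    (subst (X * X ≤_) XX'≡ (*-monoʳ-≤ X (≮⇒≥ X'≮X)))

dagger⇒square : ∀ k X Y Z → 0 < X → 0 < Y → 0 < Z → IsSolDagger k X Y Z → ∃[ b ] (0 < b × b ^ 2 ≡ Y)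
dagger⇒square k X Y Z 0<X 0<Y 0<Z E with dagger⇒RootDivides k (X + Y + Z) ≤-refl 0<X 0<Y 0<Z E
... | b , bb≡Y , _ = b , positive-cofactor b bb≡Y 0<Y , trans (cong (b *_) (*-identityʳ b)) bb≡Y

dagger⇒star-roots : ∀ k A B C → 0 < A → 0 < B → 0 < C → IsSolDagger k A B C →
  ∃[ b ] ∃[ c ] (0 < b × 0 < c × b ^ 2 ≡ B × c ^ 2 ≡ C × IsSolStar k A b c)
dagger⇒star-roots k A B C 0<A 0<B 0<C E =
  combine (dagger⇒square k A B C 0<A 0<B 0<C E) (dagger⇒square k A C B 0<A 0<C 0<B (dagger-swap k A B C E))
  where
  combine : ∃[ b ] (0 < b × b ^ 2 ≡ B) → ∃[ c ] (0 < c × c ^ 2 ≡ C) →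
    ∃[ b ] ∃[ c ] (0 < b × 0 < c × b ^ 2 ≡ B × c ^ 2 ≡ C × IsSolStar k A b c)
  combine (b , 0<b , b²≡B) (c , 0<c , c²≡C) = b , c , 0<b , 0<c , b²≡B , c²≡C ,
    from (star⇔dagger k A b c) (subst₂ (IsSolDagger k A) (sym b²≡B) (sym c²≡C) E)

proposition3p2 : (k : ℕ) →
  ((a b c : ℕ) → 0 < a → 0 < b → 0 < c → IsSolStar k a b c → IsSolDagger k a (b ^ 2) (c ^ 2))
  × ((A B C : ℕ) → 0 < A → 0 < B → 0 < C → IsSolDagger k A B C →
      ∃[ b ] ∃[ c ] (0 < b × 0 < c × b ^ 2 ≡ B × c ^ 2 ≡ C × IsSolStar k A b c))
proposition3p2 k = (λ a b c _ _ _ → to (star⇔dagger k a b c)) , dagger⇒star-roots k
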